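{- Consider the four inequalities, each understood as holding for all $a$: (i) $\Diamond\neg a\leq\neg\Box a$; (ii) $\Box\neg a\leq\neg\Diamond a$; (iii) $\neg\Diamond a\leq\Box\neg a$; (iv) $\neg\Box a\leq\Diamond\neg a$. Each of these is independent of all the others over the class of finite lattices equipped with an antitone unary operation $\neg$ with $\neg1=0$, a multiplicative unary operation $\Box$, and an additive unary operation $\Diamond$; that is, for each one of (i)–(iv) there is such a finite structure satisfying the other three but not that one.
   Context: Antitone: $a\leq b$ implies $\neg b\leq\neg a$. Multiplicative: $\Box$ preserves finite meets; additive: $\Diamond$ preserves finite joins. -}

module Defs where

open import Level using (0ℓ)
open import Data.Nat using (ℕ)
open import Data.Fin using (Fin; zero; suc)
open import Relation.Binary.Core using (Rel)
open import Relation.Binary.PropositionalEquality using (_≡_)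
open import Relation.Binary.Lattice.Structures using (IsBoundedLattice)

-- A finite lattice (carrier Fin n, up to isomorphism every finite
-- lattice is of this form; equality is propositional equality),
-- given order-theoretically with its join, meet, top and bottom,
-- equipped with
--   ¬ : antitone, with ¬ 1 = 0
--   □ : multiplicative (preserves finite meets: binary meets and 1)
--   ◇ : additive (preserves finite joins: binary joins and 0)
record FiniteNegModalLattice (n : ℕ) : Set₁ where
  infix 4 _≤_
  infixr 6 _∨_
  infixr 7 _∧_
  field
    _≤_ : Rel (Fin n) 0ℓ
    _∨_ : Fin n → Fin n → Fin n
    _∧_ : Fin n → Fin n → Fin n
    𝟙 : Fin n
    𝟘 : Fin n
    isBoundedLattice : IsBoundedLattice _≡_ _≤_ _∨_ _∧_ 𝟙 𝟘
    ¬ : Fin n → Fin n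
    □ : Fin n → Fin n
    ◇ : Fin n → Fin n
    ¬-antitone : ∀ a b → a ≤ b → ¬ b ≤ ¬ a
    ¬-top : ¬ 𝟙 ≡ 𝟘
    □-meet : ∀ a b → □ (a ∧ b) ≡ □ a ∧ □ b
    □-top : □ 𝟙 ≡ 𝟙
    ◇-join : ∀ a b → ◇ (a ∨ b) ≡ ◇ a ∨ ◇ b
    ◇-bot : ◇ 𝟘 ≡ 𝟘

Ineq : ∀ {n} → Fin 4 → FiniteNegModalLattice n → Set
Ineq zero M = ∀ a → ◇ (¬ a) ≤ ¬ (□ a)
  where open FiniteNegModalLattice M
Ineq (suc zero) M = ∀ a → □ (¬ a) ≤ ¬ (◇ a)
  where open FiniteNegModalLattice M
Ineq (suc (suc zero)) M = ∀ a → ¬ (◇ a) ≤ □ (¬ a)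
  where open FiniteNegModalLattice M
Ineq (suc (suc (suc zero))) M = ∀ a → ¬ (□ a) ≤ ◇ (¬ a)
  where open FiniteNegModalLattice M

-- All four separating structures live on the three-element chain 0 < ½ < 1.
-- On a chain every monotone map preserves binary meets and joins, so a
-- monotone □ with □1 = 1 is multiplicative and a monotone ◇ with ◇0 = 0 is
-- additive.  What is left, both of the axioms and of the four inequalities,
-- is a finite check, which is decided by evaluation.
module Submission where

open import Defs
open import Level using (Level)
open import Data.Nat using (ℕ; suc; z≤n)
open import Data.Fin using (Fin; fromℕ)
open import Data.Fin.Patterns using (0F; 1F; 2F; 3F)
open import Data.Fin.Properties using (all?; _≟_; _≤?_; ≤-totalOrder; ≤fromℕ)
open import Data.Vec using (Vec; []; _∷_; lookup)
open import Data.Product using (Σ; _×_; _,_)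
open import Function using (flip; _∘_)
open import Algebra.Core using (Op₁)
open import Relation.Nullary using (¬_)
open import Relation.Nullary.Decidable using (Dec; map′; _×-dec_; _→-dec_; ¬?; from-yes)
open import Relation.Binary.Core using (Rel; _Preserves_⟶_)
open import Relation.Binary.Bundles using (TotalOrder)
open import Relation.Binary.Definitions using (Decidable; Monotonic₁; Antitonic₁)
open import Relation.Binary.Lattice.Structures using (IsLattice; IsBoundedLattice)
open import Relation.Binary.PropositionalEquality using (_≡_; _≢_; cong)
import Algebra.Construct.NaturalChoice.Min as Min
import Algebra.Construct.NaturalChoice.Max as Max

preserves? : ∀ {m b ℓ₁ ℓ₂} {B : Set b} {R : Rel (Fin m) ℓ₁} {S : Rel B ℓ₂} →
             Decidable R → Decidable S → (f : Fin m → B) → Dec (f Preserves R ⟶ S)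
preserves? R? S? f =
  map′ (λ h {x} {y} → h x y) (λ h x y → h)
       (all? λ x → all? λ y → R? x y →-dec S? (f x) (f y))

module _ {a ℓ₁ ℓ₂ : Level} (O : TotalOrder a ℓ₁ ℓ₂) where
  open TotalOrder O
  open Min O using (_⊓_; x⊓y≤x; x⊓y≤y; ⊓-glb)
  open Max O using (_⊔_; x≤x⊔y; x≤y⊔x; ⊔-lub)

  totalOrder-isLattice : IsLattice _≈_ _≤_ _⊔_ _⊓_
  totalOrder-isLattice = record
    { isPartialOrder = isPartialOrder
    ; supremum       = λ x y → x≤x⊔y x y , x≤y⊔x x y , λ _ → ⊔-lub
    ; infimum        = λ x y → x⊓y≤x x y , x⊓y≤y x y , λ _ → ⊓-glb
    }

module Chain (n : ℕ) where
  open import Data.Fin using (_≤_)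
  open Min (≤-totalOrder (suc n)) using (_⊓_; mono-≤-distrib-⊓)
  open Max (≤-totalOrder (suc n)) using (_⊔_; mono-≤-distrib-⊔)

  isBoundedLattice : IsBoundedLattice _≡_ _≤_ _⊔_ _⊓_ (fromℕ n) 0F
  isBoundedLattice = record
    { isLattice = totalOrder-isLattice (≤-totalOrder (suc n))
    ; maximum   = ≤fromℕ
    ; minimum   = λ _ → z≤n
    }

  record Operators : Set where
    field
      neg □ ◇ : Op₁ (Fin (suc n))

  IsNegModal : Operators → Set
  IsNegModal ops =
    Antitonic₁ _≤_ _≤_ neg × neg (fromℕ n) ≡ 0F ×
    Monotonic₁ _≤_ _≤_ □ × □ (fromℕ n) ≡ fromℕ n ×
    Monotonic₁ _≤_ _≤_ ◇ × ◇ 0F ≡ 0F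
    where open Operators ops

  isNegModal? : ∀ ops → Dec (IsNegModal ops)
  isNegModal? ops =
    preserves? (flip _≤?_) _≤?_ neg ×-dec neg (fromℕ n) ≟ 0F ×-dec
    preserves? _≤?_ _≤?_ □ ×-dec □ (fromℕ n) ≟ fromℕ n ×-dec
    preserves? _≤?_ _≤?_ ◇ ×-dec ◇ 0F ≟ 0F
    where open Operators ops

  negModalLattice : (ops : Operators) → IsNegModal ops → FiniteNegModalLattice (suc n)
  negModalLattice ops (neg-antitone , neg-top , □-mono , □-top , ◇-mono , ◇-bot) = record
    { _≤_              = _≤_
    ; _∨_              = _⊔_
    ; _∧_              = _⊓_
    ; 𝟙                = fromℕ n
    ; 𝟘                = 0F
    ; isBoundedLattice = isBoundedLattice
    ; ¬                = neg
    ; □                = □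
    ; ◇                = ◇
    ; ¬-antitone       = λ _ _ → neg-antitone
    ; ¬-top            = neg-top
    ; □-meet           = mono-≤-distrib-⊓ (cong □) □-mono
    ; □-top            = □-top
    ; ◇-join           = mono-≤-distrib-⊔ (cong ◇) ◇-mono
    ; ◇-bot            = ◇-bot
    }
    where open Operators ops

Separates : ∀ {n} → FiniteNegModalLattice n → Fin 4 → Set
Separates M k = ((j : Fin 4) → j ≢ k → Ineq j M) × ¬ Ineq k M

module _ {n : ℕ} (M : FiniteNegModalLattice n)
         (_≤ᴹ?_ : Decidable (FiniteNegModalLattice._≤_ M)) where
  open FiniteNegModalLattice M using (□; ◇) renaming (¬ to neg)

  ineq? : ∀ k → Dec (Ineq k M)
  ineq? 0F = all? λ a → ◇ (neg a) ≤ᴹ? neg (□ a)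
  ineq? 1F = all? λ a → □ (neg a) ≤ᴹ? neg (◇ a)
  ineq? 2F = all? λ a → neg (◇ a) ≤ᴹ? □ (neg a)
  ineq? 3F = all? λ a → neg (□ a) ≤ᴹ? ◇ (neg a)

  separates? : ∀ k → Dec (Separates M k)
  separates? k = (all? λ j → ¬? (j ≟ k) →-dec ineq? j) ×-dec ¬? (ineq? k)

open Chain 2

operators : (neg □ ◇ : Vec (Fin 3) 3) → Operators
operators neg □ ◇ = record { neg = lookup neg ; □ = lookup □ ; ◇ = lookup ◇ }

-- The chain 0 < ½ < 1 is 0F < 1F < 2F.  Inequality k fails in model k at the
-- element a noted above its clause.
countermodelOperators : Fin 4 → Operators
-- a = 0:  ◇¬0 = 1,  ¬□0 = ½
countermodelOperators 0F = operators (1F ∷ 0F ∷ 0F ∷ []) (0F ∷ 1F ∷ 2F ∷ []) (0F ∷ 2F ∷ 2F ∷ [])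
-- a = 1:  □¬1 = ½,  ¬◇1 = 0
countermodelOperators 1F = operators (0F ∷ 0F ∷ 0F ∷ []) (1F ∷ 1F ∷ 2F ∷ []) (0F ∷ 0F ∷ 0F ∷ [])
-- a = 0:  ¬◇0 = ½,  □¬0 = 0
countermodelOperators 2F = operators (1F ∷ 1F ∷ 0F ∷ []) (0F ∷ 0F ∷ 2F ∷ []) (0F ∷ 1F ∷ 1F ∷ [])
-- a = 0:  ¬□0 = ½,  ◇¬0 = 0
countermodelOperators 3F = operators (1F ∷ 1F ∷ 0F ∷ []) (0F ∷ 1F ∷ 2F ∷ []) (0F ∷ 0F ∷ 2F ∷ [])

countermodel-isNegModal : ∀ k → IsNegModal (countermodelOperators k)
countermodel-isNegModal = from-yes (all? (isNegModal? ∘ countermodelOperators))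

countermodel : Fin 4 → FiniteNegModalLattice 3
countermodel k = negModalLattice (countermodelOperators k) (countermodel-isNegModal k)

countermodel-separates : ∀ k → Separates (countermodel k) k
countermodel-separates = from-yes (all? λ k → separates? (countermodel k) _≤?_ k)

proposition4p1 : (k : Fin 4) →
    Σ ℕ (λ n → Σ (FiniteNegModalLattice n) (λ M →
      ((j : Fin 4) → j ≢ k → Ineq j M) × ¬ Ineq k M))
proposition4p1 k = 3 , countermodel k , countermodel-separates k
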